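{- Let $(S,\ast)$ be a commutative adequate partial semigroup, let $\mathcal{T}$ be the set of all adequate sequences in $S$, and let $A$ be a $J_\delta$-set in $S$. Then for all $F\in\mathcal{P}_f(\mathcal{T})$, all $r\in\mathbb{N}$ and all $W\in\mathcal{P}_f(S)$, there exist $a\in\sigma(W)$ and $H\in\mathcal{P}_f(\mathbb{N})$ such that $\min H>r$ and for all $f\in F$, $\prod_{t\in H}f(t)\in\sigma(W\ast a)$ and $a\ast\prod_{t\in H}f(t)\in A$.
   Context: A partial semigroup is a pair $(S,\ast)$ where $\ast$ is an operation defined on a subset $X\subseteq S\times S$ such that for all $x,y,z\in S$, $(x\ast y)\ast z=x\ast(y\ast z)$ in the sense that if either side is defined then so is the other and they are equal; it is commutative if $x\ast y=y\ast x$ whenever defined. For $s\in S$, $\phi(s)=\{t\in S: s\ast t \text{ is defined}\}$; for finite nonempty $K\subseteq S$, $\sigma(K)=\bigcap_{s\in K}\phi(s)$. $(S,\ast)$ is adequate if $\sigma(K)\neq\emptyset$ for every finite nonempty $K\subseteq S$. $\mathcal{P}_f(X)$ denotes the set of finite nonempty subsets of $X$. For finite $W_1,W_2\subseteq S$, $W_1\ast W_2=\{w_1\ast w_2: w_1\in W_1, w_2\in W_2, w_1\ast w_2\text{ defined}\}$, and $W\ast a$ means $W\ast\{a\}$. A sequence $\langle y_n\rangle_{n=1}^\infty$ in $S$ is adequate if $\prod_{n\in F}y_n$ is defined for every $F\in\mathcal{P}_f(\mathbb{N})$ and for every $K\in\mathcal{P}_f(S)$ there is $m\in\mathbb{N}$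 with $\{\prod_{n\in F}y_n: F\in\mathcal{P}_f(\mathbb{N}), \min F\ge m\}\subseteq\sigma(K)$. A set $A\subseteq S$ is a $J_\delta$-set if for every $F\in\mathcal{P}_f(\mathcal{T})$ and every $W\in\mathcal{P}_f(S)$ there exist $a\in\sigma(W)$ and $H\in\mathcal{P}_f(\mathbb{N})$ such that for each $f\in F$, $\prod_{t\in H}f(t)\in\sigma(W\ast a)$ and $a\ast\prod_{t\in H}f(t)\in A$. -}

module Defs where

open import Data.Nat using (ℕ; zero; suc; _<_; _≤_)
open import Data.Maybe using (Maybe; just; nothing; _>>=_; Is-just)
open import Data.List using (List; _∷_)
open import Data.List.NonEmpty using (List⁺; _∷_; toList; head; foldr₁; map)
open import Data.List.Membership.Propositional using (_∈_)
open import Data.List.Relation.Unary.All using (All)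
open import Data.List.Relation.Unary.Linked using (Linked)
open import Data.Product using (Σ; ∃; _×_; _,_)
open import Data.Empty using (⊥)
open import Relation.Binary.PropositionalEquality using (_≡_)

-- A partial operation on S: x ∗ y = nothing means "undefined".
module PartialSemigroupDefs {S : Set} (_∗_ : S → S → Maybe S) where

  Defined : Maybe S → Set
  Defined = Is-just

  _∈ᴹ_ : Maybe S → (S → Set) → Set
  nothing ∈ᴹ P = ⊥
  just x  ∈ᴹ P = P x

  _⊛_ : Maybe S → Maybe S → Maybe S
  mx ⊛ my = mx >>= λ x → my >>= λ y → x ∗ y

  -- associativity in the partial-semigroup sense: either side defined iff the
  -- other is, and then they are equal
  IsAssociative : Set
  IsAssociative = ∀ x y z → ((x ∗ y) >>= λ u → u ∗ z) ≡ ((y ∗ z) >>= λ v → x ∗ v)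

  IsCommutative : Set
  IsCommutative = ∀ x y → x ∗ y ≡ y ∗ x

  φ : S → S → Set
  φ s t = Defined (s ∗ t)

  σ : (S → Set) → S → Set
  σ K t = ∀ s → K s → φ s t

  -- finite nonempty subsets of S are represented by nonempty lists
  ⟦_⟧ : List⁺ S → S → Set
  ⟦ K ⟧ s = s ∈ toList K

  IsAdequate : Set
  IsAdequate = ∀ (K : List⁺ S) → ∃ λ t → σ ⟦ K ⟧ t

  _∗ˢ_ : List⁺ S → S → S → Set
  (W ∗ˢ a) s = Σ S λ w → (w ∈ toList W) × (w ∗ a ≡ just s)

  -- P_f(ℕ) with ℕ = {1,2,...}: a nonempty strictly increasing list of
  -- positive naturals (canonical representation of a finite nonempty set).
  record Pfℕ : Set where
    constructor mkPfℕ
    field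
      elems   : List⁺ ℕ
      sorted  : Linked _<_ (0 ∷ toList elems)

  minᴾ : Pfℕ → ℕ
  minᴾ H = head (Pfℕ.elems H)

  -- ∏_{t ∈ H} f(t), computed in increasing order of t
  prod : (ℕ → S) → Pfℕ → Maybe S
  prod f H = foldr₁ _⊛_ (map (λ t → just (f t)) (Pfℕ.elems H))

  -- adequate sequences (the index 0 is never used: sequences start at 1)
  IsAdequateSeq : (ℕ → S) → Set
  IsAdequateSeq y =
    (∀ (H : Pfℕ) → Defined (prod y H)) ×
    (∀ (K : List⁺ S) → ∃ λ m → ∀ (H : Pfℕ) → m ≤ minᴾ H → prod y H ∈ᴹ σ ⟦ K ⟧)

  -- J_δ-sets. A finite nonempty set F of adequate sequences is a nonempty
  -- list of sequences together with a proof that each is adequate.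
  IsJδ : (S → Set) → Set
  IsJδ A =
    ∀ (F : List⁺ (ℕ → S)) → All IsAdequateSeq (toList F) →
    ∀ (W : List⁺ S) →
    Σ S λ a → σ ⟦ W ⟧ a × Σ Pfℕ λ H →
      All (λ f → Σ S λ p → (prod f H ≡ just p) × σ (W ∗ˢ a) p × ((a ∗ p) ∈ᴹ A))
          (toList F)

module Submission where

-- Shifting the indices of the sequences by r turns the J_δ
-- property into its "min H > r" refinement.  For a sequence f put
-- f⁺ʳ(t) = f(r + t), and for H ∈ P_f(ℕ) put H + r = {r + t : t ∈ H}.  Then
--   (1) ∏_{t∈H} f⁺ʳ(t) = ∏_{t∈H+r} f(t)  (the products agree factor by factor),
--   (2) min (H + r) = r + min H > r, since elements of P_f(ℕ) are positive,
--   (3) f⁺ʳ is adequate whenever f is (by (1), using that min (H+r) ≥ min H).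
-- Applying the J_δ property of A to the shifted family {f⁺ʳ : f ∈ F} yields
-- a ∈ σ(W) and H; then H + r is the required set, by (1) and (2).

open import Defs
open import Data.Nat using (ℕ; _<_; _≤_; _+_)
open import Data.Nat.Properties using (+-monoʳ-<; m≤n+m; m<m+n; <-≤-trans; ≤-trans)
open import Data.Maybe using (Maybe; just)
import Data.List as List
open import Data.List.NonEmpty using (List⁺; _∷_; toList)
import Data.List.NonEmpty as List⁺
open import Data.List.NonEmpty.Properties using (map-∘)
open import Data.List.Relation.Unary.All using (All)
import Data.List.Relation.Unary.All as All
import Data.List.Relation.Unary.All.Properties as All
open import Data.List.Relation.Unary.Linked using (_∷_)
import Data.List.Relation.Unary.Linked as Linked
import Data.List.Relation.Unary.Linked.Properties as Linked
open import Data.Product using (Σ; _×_; _,_)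
open import Relation.Binary.PropositionalEquality using (_≡_; refl; sym; trans; cong; subst)

All-map⁺ : {A B : Set} {P : B → Set} (g : A → B) (xs : List⁺ A) →
           All (λ x → P (g x)) (toList xs) → All P (toList (List⁺.map g xs))
All-map⁺ g (x ∷ xs) ps = All.map⁺ ps

All-map⁻ : {A B : Set} {P : B → Set} (g : A → B) (xs : List⁺ A) →
           All P (toList (List⁺.map g xs)) → All (λ x → P (g x)) (toList xs)
All-map⁻ g (x ∷ xs) ps = All.map⁻ ps

module Shifting {S : Set} (_∗_ : S → S → Maybe S) where
  open PartialSemigroupDefs _∗_

  shiftᴾ : ℕ → Pfℕ → Pfℕ
  shiftᴾ r (mkPfℕ (x ∷ xs) (0<x ∷ sorted)) =
    mkPfℕ (r + x ∷ List.map (r +_) xs)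
          (<-≤-trans 0<x (m≤n+m x r) ∷ Linked.map⁺ (Linked.map (+-monoʳ-< r) sorted))

  minᴾ-shiftᴾ : ∀ r H → minᴾ (shiftᴾ r H) ≡ r + minᴾ H
  minᴾ-shiftᴾ r (mkPfℕ (x ∷ xs) (_ ∷ _)) = refl

  minᴾ-positive : ∀ H → 0 < minᴾ H
  minᴾ-positive (mkPfℕ (x ∷ xs) (0<x ∷ _)) = 0<x

  r<minᴾ-shiftᴾ : ∀ r H → r < minᴾ (shiftᴾ r H)
  r<minᴾ-shiftᴾ r H = subst (r <_) (sym (minᴾ-shiftᴾ r H)) (m<m+n r (minᴾ-positive H))

  minᴾ≤minᴾ-shiftᴾ : ∀ r H → minᴾ H ≤ minᴾ (shiftᴾ r H)
  minᴾ≤minᴾ-shiftᴾ r H = subst (minᴾ H ≤_) (sym (minᴾ-shiftᴾ r H)) (m≤n+m (minᴾ H) r)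

  shiftSeq : ℕ → (ℕ → S) → ℕ → S
  shiftSeq r f t = f (r + t)

  prod-shift : ∀ r f H → prod (shiftSeq r f) H ≡ prod f (shiftᴾ r H)
  prod-shift r f (mkPfℕ (x ∷ xs) (_ ∷ _)) =
    cong (List⁺.foldr₁ _⊛_) (map-∘ {g = λ t → just (f t)} {f = r +_} (x ∷ xs))

  -- Step (3): shifts of adequate sequences are adequate, with the same
  -- threshold m for each K.
  shift-adequate : ∀ r {f} → IsAdequateSeq f → IsAdequateSeq (shiftSeq r f)
  shift-adequate r {f} (defined , eventually) = defined⁺ , eventually⁺
    where
    defined⁺ : ∀ H → Defined (prod (shiftSeq r f) H)
    defined⁺ H = subst Defined (sym (prod-shift r f H)) (defined (shiftᴾ r H))

    eventually⁺ : ∀ K → Σ ℕ λ m → ∀ H → m ≤ minᴾ H → prod (shiftSeq r f) H ∈ᴹ σ ⟦ K ⟧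
    eventually⁺ K with eventually K
    ... | m , inσK = m , λ H m≤minH →
      subst (_∈ᴹ σ ⟦ K ⟧) (sym (prod-shift r f H))
            (inσK (shiftᴾ r H) (≤-trans m≤minH (minᴾ≤minᴾ-shiftᴾ r H)))

  JδWitness : (A : S → Set) (W : List⁺ S) (a : S) (H : Pfℕ) (f : ℕ → S) → Set
  JδWitness A W a H f = Σ S λ p → (prod f H ≡ just p) × σ (W ∗ˢ a) p × ((a ∗ p) ∈ᴹ A)

  witness-unshift : ∀ {A W a} r H f →
                    JδWitness A W a H (shiftSeq r f) → JδWitness A W a (shiftᴾ r H) f
  witness-unshift r H f (p , ∏≡p , p∈σ , a∗p∈A) =
    p , trans (sym (prod-shift r f H)) ∏≡p , p∈σ , a∗p∈A

  Jδ-above-every-level :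
    ∀ {A} → IsJδ A → ∀ F → All IsAdequateSeq (toList F) → ∀ r W →
    Σ S λ a → σ ⟦ W ⟧ a × Σ Pfℕ λ H → (r < minᴾ H) × All (JδWitness A W a H) (toList F)
  Jδ-above-every-level isJδ F adequateF r W
    with isJδ (List⁺.map (shiftSeq r) F) shifted-adequate W
    where
    shifted-adequate : All IsAdequateSeq (toList (List⁺.map (shiftSeq r) F))
    shifted-adequate = All-map⁺ (shiftSeq r) F (All.map (shift-adequate r) adequateF)
  ... | a , a∈σW , H , witnesses =
    a , a∈σW , shiftᴾ r H , r<minᴾ-shiftᴾ r H ,
    All.map (witness-unshift r H _) (All-map⁻ (shiftSeq r) F witnesses)

lemma3p3 : {S : Set} (_∗_ : S → S → Maybe S) →
    let open PartialSemigroupDefs _∗_ in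
    IsAssociative → IsCommutative → IsAdequate →
    (A : S → Set) → IsJδ A →
    (F : List⁺ (ℕ → S)) → All IsAdequateSeq (toList F) →
    (r : ℕ) (W : List⁺ S) →
    Σ S λ a → σ ⟦ W ⟧ a × Σ Pfℕ λ H → (r < minᴾ H) ×
      All (λ f → Σ S λ p → (prod f H ≡ just p) × σ (W ∗ˢ a) p × ((a ∗ p) ∈ᴹ A))
          (toList F)
lemma3p3 _∗_ _ _ _ A = Shifting.Jδ-above-every-level _∗_
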